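{- Let $G$ be a median graph with basepoint $v_0$. Let $m\in V$ and let $L,L^*$ be two POFs outgoing from $m$. Let $u,v$ be vertices with $m\in I(v_0,u)$ and $m\in I(v_0,v)$ such that $L_{m,u}=L$ and $L_{m,v}=L^*$. Then $m\in I(u,v)$ if and only if $L\cap L^*=\emptyset$.
   Context: $G=(V,E)$ is a finite, simple, connected, undirected median graph: for all vertices $x,y,z$ the set $I(x,y)\cap I(y,z)\cap I(z,x)$ has exactly one element, where $I(u,v)=\{w: d(u,w)+d(w,v)=d(u,v)\}$. Edges $uv,xy$ are in relation $\Theta_0$ if $uvyx$ is a 4-cycle; $\Theta$ is the reflexive transitive closure of $\Theta_0$, with equivalence classes ($\Theta$-classes). For each class, removing its edges leaves exactly two connected components (halfspaces). Classes $E_i,E_j$ are orthogonal if there is a 4-cycle $uvyx$ with $uv,xy\in E_i$, $ux,vy\in E_j$; a POF is a set of classes any two distinct members of which are orthogonal. Each edge $xy$ is oriented from $x$ to $y$ when $d(v_0,x)<d(v_0,y)$; a POF $L$ is outgoing from $m$ if every class of $L$ has an edge oriented out of $m$. The signature $\sigma_{x,y}$ is the set of classes separating $x$ and $y$. For $x\in I(v_0,y)$, the ladder set $L_{x,y}$ is the set of classes in $\sigma_{x,y}$ having an edge incident to $x$. -}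

module Defs where

open import Data.Nat using (ℕ; zero; suc; _+_; _≤_; _<_)
open import Data.Fin using (Fin)
open import Data.Product using (Σ; ∃; _×_; _,_; proj₁; proj₂)
open import Data.Unit using (⊤)
open import Relation.Nullary using (¬_; Dec)
open import Relation.Binary.PropositionalEquality using (_≡_; _≢_)
open import Relation.Binary.Construct.Closure.ReflexiveTransitive using (Star)

module _ {n : ℕ} (Adj : Fin n → Fin n → Set) where

  V : Set
  V = Fin n

  data Walk (R : V → V → Set) : V → V → ℕ → Set where
    [] : ∀ {u} → Walk R u u zero
    step : ∀ {u v w k} → Adj u v → R u v → Walk R v w k → Walk R u w (suc k)

  Any : V → V → Set
  Any _ _ = ⊤

  Dist : V → V → ℕ → Set
  Dist u v k = Walk Any u v k × (∀ j → Walk Any u v j → k ≤ j)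

  InInterval : V → V → V → Set
  InInterval u v w = Σ ℕ λ a → Σ ℕ λ b → Dist u w a × Dist w v b × Dist u v (a + b)

  -- Edges are represented by darts (ordered adjacent pairs); a dart and its
  -- reverse represent the same edge (they are Θ-related, see below).
  Dart : Set
  Dart = Σ V λ u → Σ V λ v → Adj u v

  tail head : Dart → V
  tail (u , _ , _) = u
  head (_ , v , _) = v

  FourCycle : V → V → V → V → Set
  FourCycle u v y x = Adj u v × Adj v y × Adj y x × Adj x u × u ≢ y × v ≢ x

  data Step : Dart → Dart → Set where
    θ₀ : ∀ {u v x y} (a : Adj u v) (b : Adj x y) → FourCycle u v y x →
         Step (u , v , a) (x , y , b)
    flip : ∀ {u v} (a : Adj u v) (b : Adj v u) → Step (u , v , a) (v , u , b)

  -- Θ : reflexive transitive closure (Θ₀ and Flip are symmetric, so this is an equivalence)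
  Θ : Dart → Dart → Set
  Θ = Star Step

  -- A set of Θ-classes, represented as a Θ-saturated set of darts (union of its classes)
  EdgeSet : Set₁
  EdgeSet = Dart → Set

  IsClassSet : EdgeSet → Set
  IsClassSet S = ∀ e f → Θ e f → S e → S f

  Orthogonal : Dart → Dart → Set
  Orthogonal e f = Σ V λ u → Σ V λ v → Σ V λ y → Σ V λ x → FourCycle u v y x ×
    Σ (Adj u v) (λ uv → Θ e (u , v , uv)) × Σ (Adj x y) (λ xy → Θ e (x , y , xy)) ×
    Σ (Adj u x) (λ ux → Θ f (u , x , ux)) × Σ (Adj v y) (λ vy → Θ f (v , y , vy))

  IsPOF : EdgeSet → Set
  IsPOF S = ∀ e f → S e → S f → ¬ Θ e f → Orthogonal e f

  OrientedOut : V → V → V → Set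
  OrientedOut v₀ m y = Σ ℕ λ a → Σ ℕ λ b → Dist v₀ m a × Dist v₀ y b × a < b

  OutgoingFrom : V → V → EdgeSet → Set
  OutgoingFrom v₀ m S = ∀ e → S e → Σ V λ y → Σ (Adj m y) λ a → OrientedOut v₀ m y × Θ e (m , y , a)

  NotInClass : Dart → V → V → Set
  NotInClass e u v = (a : Adj u v) → ¬ Θ e (u , v , a)

  Separates : Dart → V → V → Set
  Separates e x y = ∀ k → ¬ Walk (NotInClass e) x y k

  σ : V → V → EdgeSet
  σ x y e = Separates e x y

  Ladder : V → V → EdgeSet
  Ladder x y e = σ x y e × Σ V λ z → Σ (Adj x z) λ a → Θ e (x , z , a)

  SameSet : EdgeSet → EdgeSet → Set
  SameSet S T = ∀ e → (S e → T e) × (T e → S e)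

  Disjoint : EdgeSet → EdgeSet → Set
  Disjoint S T = ∀ e → ¬ (S e × T e)

record IsMedianGraph {n : ℕ} (Adj : Fin n → Fin n → Set) : Set where
  field
    adj-dec : ∀ u v → Dec (Adj u v)
    adj-sym : ∀ {u v} → Adj u v → Adj v u
    adj-irrefl : ∀ {u} → ¬ Adj u u
    connected : ∀ u v → ∃ λ k → Walk Adj (Any Adj) u v k
    median : ∀ x y z → Σ (Fin n) λ w →
      (InInterval Adj x y w × InInterval Adj y z w × InInterval Adj z x w) ×
      (∀ w' → InInterval Adj x y w' → InInterval Adj y z w' → InInterval Adj z x w' → w' ≡ w)

-- A Θ-class is a cut of the vertex set: Θ₀ (opposite edges of a 4-cycle) and edge reversal
-- preserve, up to swapping, the partition of the vertices by which end of an edge is nearer.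
-- If m ∈ I(u,v) and a class lay in both ladders, a geodesic u → m → v would cross it once
-- before m and once after; but the first crossing separates u from m and the second does
-- not, so they cannot cut alike. Conversely, if the median z of m, u, v is not m, the first
-- edge m y of a geodesic from m towards z is in both ladders: y is nearer than m to u and
-- to v, and a walk avoiding the class of m y never changes sides, because in a median graph
-- every edge joining the two sides of pq is Θ-related to pq (induction on the distance to
-- p, closing quadrangles).
module Submission where

open import Defs
open import Data.Nat using (ℕ)
open import Data.Fin using (Fin)
open import Function.Bundles using (_⇔_)

open import Data.Bool using (Bool; true; false; not)
open import Data.Bool.Properties using (not-injective)
open import Data.Fin using () renaming (_≟_ to _≟ᶠ_)
open import Data.Nat using (zero; suc; _+_; _≤_; _<_; z≤n; s≤s; _<?_)
open import Data.Nat.Properties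
open import Data.Product using (Σ; _×_; _,_; proj₁; proj₂)
open import Data.Sum using (_⊎_; inj₁; inj₂)
open import Data.Unit using (tt)
open import Function.Base using (_∘_; id)
open import Function.Bundles using (Equivalence; mk⇔)
import Function.Properties.Equivalence as ⇔
open import Relation.Binary.Construct.Closure.ReflexiveTransitive using (ε; _◅_; _◅◅_)
open import Relation.Binary.PropositionalEquality
open import Relation.Nullary using (¬_; yes; no; does; contradiction)
open import Relation.Nullary.Decidable using (dec-true; dec-false)

x+x≡2⇒x≡1 : ∀ x → x + x ≡ 2 → x ≡ 1
x+x≡2⇒x≡1 zero ()
x+x≡2⇒x≡1 (suc zero) _ = refl
x+x≡2⇒x≡1 (suc (suc x)) eq =
  contradiction (m+n≡0⇒n≡0 x (suc-injective (suc-injective eq))) λ ()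

module MedianGraph {n : ℕ} {Adj : Fin n → Fin n → Set} (G : IsMedianGraph Adj) where
  open IsMedianGraph G

  private
    variable
      a b m p q t u v w x y z : Fin n
      i j k : ℕ
      R : Fin n → Fin n → Set
      e f : Dart Adj

  AnyWalk : Fin n → Fin n → ℕ → Set
  AnyWalk = Walk Adj (Any Adj)

  _++ʷ_ : Walk Adj R x y i → Walk Adj R y z j → Walk Adj R x z (i + j)
  [] ++ʷ w′ = w′
  step xy r w₁ ++ʷ w′ = step xy r (w₁ ++ʷ w′)

  reverse : (∀ {x y} → Adj x y → R x y → R y x) → Walk Adj R x y i → Walk Adj R y x i
  reverse {R = R} {i = i} R-sym w₁ = subst (Walk Adj R _ _) (+-identityʳ i) (go w₁ [])
    where
    go : Walk Adj R x y j → Walk Adj R x z k → Walk Adj R y z (j + k)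
    go [] acc = acc
    go {j = suc j} {k = k} (step xy r w₁) acc =
      subst (Walk Adj R _ _) (+-suc j k) (go w₁ (step (adj-sym xy) (R-sym xy r) acc))

  walk-zero : Walk Adj R x y 0 → x ≡ y
  walk-zero [] = refl

  -- The median axiom alone provides a geodesic between any two vertices.
  distance : ∀ x y → Σ ℕ (Dist Adj x y)
  distance x y with median x y y
  ... | _ , ((i , j , _ , _ , D) , _) , _ = i + j , D

  d : Fin n → Fin n → ℕ
  d x y = proj₁ (distance x y)

  geodesic : ∀ x y → AnyWalk x y (d x y)
  geodesic x y = proj₁ (proj₂ (distance x y))

  d-minimal : AnyWalk x y k → d x y ≤ k
  d-minimal {x} {y} w₁ = proj₂ (proj₂ (distance x y)) _ w₁

  Dist⇒d≡ : Dist Adj x y k → d x y ≡ k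
  Dist⇒d≡ D = ≤-antisym (d-minimal (proj₁ D)) (proj₂ D _ (geodesic _ _))

  d-sym : ∀ x y → d x y ≡ d y x
  d-sym x y =
    ≤-antisym (d-minimal (reverse _ (geodesic y x))) (d-minimal (reverse _ (geodesic x y)))

  d-triangle : ∀ x y z → d x z ≤ d x y + d y z
  d-triangle x y z = d-minimal (geodesic x y ++ʷ geodesic y z)

  d≡0⇒≡ : d x y ≡ 0 → x ≡ y
  d≡0⇒≡ {x} {y} eq = walk-zero (subst (AnyWalk x y) eq (geodesic x y))

  d-refl : ∀ x → d x x ≡ 0
  d-refl x = n≤0⇒n≡0 (d-minimal {x} {x} [])

  d-adj : Adj x y → d x y ≡ 1
  d-adj {x} xy = ≤-antisym (d-minimal (step xy tt []))
    (n≢0⇒n>0 λ eq → adj-irrefl (subst (Adj x) (sym (d≡0⇒≡ eq)) xy))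

  d≡1⇒adj : d x y ≡ 1 → Adj x y
  d≡1⇒adj {x} {y} eq with subst (AnyWalk x y) eq (geodesic x y)
  ... | step xy _ [] = xy

  d-stepˡ : Adj x y → ∀ t → d y t ≤ suc (d x t)
  d-stepˡ {x} {y} xy t =
    ≤-trans (d-triangle y x t) (≤-reflexive (cong (_+ d x t) (d-adj (adj-sym xy))))

  d-stepʳ : Adj x y → ∀ t → d t y ≤ suc (d t x)
  d-stepʳ {x} {y} xy t = subst₂ (λ l r → l ≤ suc r) (d-sym y t) (d-sym x t) (d-stepˡ xy t)

  first-step : d x y ≡ suc k → Σ (Fin n) λ x′ → Adj x x′ × d x′ y ≡ k
  first-step {x} {y} eq with subst (AnyWalk x y) eq (geodesic x y)
  ... | step {v = x′} xx′ _ w₁ =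
    x′ , xx′ , ≤-antisym (d-minimal w₁)
                 (≤-pred (subst (_≤ suc (d x′ y)) eq (d-stepˡ (adj-sym xx′) y)))

  neighbour-toward : x ≢ y → Σ (Fin n) λ x′ → Adj x x′ × d x′ y < d x y
  neighbour-toward {x} {y} x≢y with d x y in eq
  ... | zero = contradiction (d≡0⇒≡ eq) x≢y
  ... | suc k with first-step eq
  ...   | x′ , xx′ , eq′ = x′ , xx′ , ≤-reflexive (cong suc eq′)

  interval⇒d+d : InInterval Adj x y w → d x w + d w y ≡ d x y
  interval⇒d+d (_ , _ , D₁ , D₂ , D₃) =
    trans (cong₂ _+_ (Dist⇒d≡ D₁) (Dist⇒d≡ D₂)) (sym (Dist⇒d≡ D₃))

  d+d⇒interval : d x w + d w y ≡ d x y → InInterval Adj x y w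
  d+d⇒interval {x = x} {w = w} {y = y} eq =
    d x w , d w y , proj₂ (distance x w) , proj₂ (distance w y) ,
    subst (Dist Adj x y) (sym eq) (proj₂ (distance x y))

  interval-sym : InInterval Adj x y w → InInterval Adj y x w
  interval-sym {x = x} {y = y} {w = w} I = d+d⇒interval (begin
    d y w + d w x ≡⟨ cong₂ _+_ (d-sym y w) (d-sym w x) ⟩
    d w y + d x w ≡⟨ +-comm (d w y) (d x w) ⟩
    d x w + d w y ≡⟨ interval⇒d+d I ⟩
    d x y         ≡⟨ d-sym x y ⟩
    d y x         ∎)
    where open ≡-Reasoning

  interval-of-edge : Adj a b → InInterval Adj a b z → z ≡ a ⊎ z ≡ b
  interval-of-edge {a} {b} {z} ab I with d a z in eq
  ... | zero = inj₁ (sym (d≡0⇒≡ eq))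
  ... | suc c = inj₂ (d≡0⇒≡ (m+n≡0⇒n≡0 c (suc-injective (begin
    suc c + d z b ≡⟨ cong (_+ d z b) (sym eq) ⟩
    d a z + d z b ≡⟨ interval⇒d+d I ⟩
    d a b         ≡⟨ d-adj ab ⟩
    1             ∎))))
    where open ≡-Reasoning

  -- The median of t, a, b is a or b, so one of d t a, d t b exceeds the other by one.
  bipartite : Adj a b → ∀ t → d t a ≢ d t b
  bipartite {a} {b} ab t eq with median t a b
  ... | z , (I-ta , I-ab , I-bt) , _ with interval-of-edge ab I-ab
  ... | inj₁ refl = 1+n≢n (begin
    suc (d t a)   ≡⟨ cong₂ _+_ (sym (d-adj (adj-sym ab))) (d-sym t a) ⟩
    d b a + d a t ≡⟨ interval⇒d+d I-bt ⟩
    d b t         ≡⟨ d-sym b t ⟩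
    d t b         ≡⟨ sym eq ⟩
    d t a         ∎)
    where open ≡-Reasoning
  ... | inj₂ refl = m+1+n≢m (d t b) (begin
    d t b + 1     ≡⟨ cong (d t b +_) (sym (d-adj (adj-sym ab))) ⟩
    d t b + d b a ≡⟨ interval⇒d+d I-ta ⟩
    d t a         ≡⟨ eq ⟩
    d t b         ∎)
    where open ≡-Reasoning

  adj-<⇒≡suc : Adj a b → d t a < d t b → d t b ≡ suc (d t a)
  adj-<⇒≡suc ab lt = ≤-antisym (d-stepʳ ab _) lt

  adj-≮⇒> : Adj a b → ¬ d t a < d t b → d t b < d t a
  adj-≮⇒> {t = t} ab ≮ = ≤∧≢⇒< (≮⇒≥ ≮) (bipartite ab t ∘ sym)

  distinct-levels : d x t ≡ k → d y t ≡ suc (suc k) → x ≢ y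
  distinct-levels {k = k} dx dy refl = <⇒≢ (m<n⇒m<1+n (n<1+n k)) (trans (sym dx) dy)

  triangle-lower-bound : k + j ≤ d x z → d y z ≤ j → k ≤ d x y
  triangle-lower-bound {k} {j} {x} {z} {y} le dyz = +-cancelʳ-≤ j k (d x y) (begin
    k + j         ≤⟨ le ⟩
    d x z         ≤⟨ d-triangle x y z ⟩
    d x y + d y z ≤⟨ +-monoʳ-≤ (d x y) dyz ⟩
    d x y + j     ∎)
    where open ≤-Reasoning

  geodesic-crosses-edge : AnyWalk x p i → Adj p q → AnyWalk q y j → d x y ≡ i + suc j →
    d x p < d x q × d y q < d y p
  geodesic-crosses-edge {x} {p} {i} {q} {y} {j} A _ B geo =
    ≤-trans (s≤s (d-minimal A)) (triangle-lower-bound (≤-reflexive (sym dxy)) (d-minimal B)) ,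
    ≤-trans (s≤s dyq≤j) (triangle-lower-bound (≤-reflexive (sym dyx)) dpx≤i)
    where
    dxy : d x y ≡ suc i + j
    dxy = trans geo (+-suc i j)
    dyq≤j : d y q ≤ j
    dyq≤j = subst (_≤ j) (d-sym q y) (d-minimal B)
    dpx≤i : d p x ≤ i
    dpx≤i = subst (_≤ i) (d-sym x p) (d-minimal A)
    dyx : d y x ≡ suc j + i
    dyx = trans (d-sym y x) (trans geo (+-comm i (suc j)))

  common-neighbour-distance : Adj x w → Adj w y → x ≢ y → d x y ≡ 2
  common-neighbour-distance {x} {w} {y} xw wy x≢y =
    ≤-antisym (d-minimal (step xw tt (step wy tt [])))
      (≤∧≢⇒< (n≢0⇒n>0 (x≢y ∘ d≡0⇒≡)) λ eq →
        bipartite (d≡1⇒adj (sym eq)) w (trans (d-adj (adj-sym xw)) (sym (d-adj wy))))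

  quadrangle : d x y ≡ 2 → d x t ≡ suc k → d y t ≡ suc k →
    Σ (Fin n) λ w → Adj x w × Adj w y × d w t ≡ k
  quadrangle {x} {y} {t} {k} dxy dxt dyt with median x y t
  ... | w , (I-xy , I-yt , I-tx) , _ = w , d≡1⇒adj dxw≡1 , d≡1⇒adj dwy≡1 , dwt≡k
    where
    via-x : d x w + d w t ≡ suc k
    via-x = trans (cong₂ _+_ (d-sym x w) (d-sym w t))
      (trans (+-comm (d w x) (d t w)) (trans (interval⇒d+d I-tx) (trans (d-sym t x) dxt)))
    via-y : d w y + d w t ≡ suc k
    via-y = trans (cong (_+ d w t) (d-sym w y)) (trans (interval⇒d+d I-yt) dyt)
    dwy≡dxw : d w y ≡ d x w
    dwy≡dxw = +-cancelʳ-≡ (d w t) _ _ (trans via-y (sym via-x))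
    dxw≡1 : d x w ≡ 1
    dxw≡1 = x+x≡2⇒x≡1 _
      (trans (cong (d x w +_) (sym dwy≡dxw)) (trans (interval⇒d+d I-xy) dxy))
    dwy≡1 : d w y ≡ 1
    dwy≡1 = trans dwy≡dxw dxw≡1
    dwt≡k : d w t ≡ k
    dwt≡k = suc-injective (trans (cong (_+ d w t) (sym dxw≡1)) via-x)

  quadrangle-is-median : Adj x w → Adj w y → d x y ≡ 2 → d w t ≡ k →
    d x t ≡ suc k → d y t ≡ suc k → w ≡ proj₁ (median x y t)
  quadrangle-is-median {x} {w} {y} {t} {k} xw wy dxy dwt dxt dyt =
    proj₂ (proj₂ (median x y t)) w
      (d+d⇒interval (trans (cong₂ _+_ (d-adj xw) (d-adj wy)) (sym dxy)))
      (d+d⇒interval (trans (cong₂ _+_ (d-adj (adj-sym wy)) dwt) (sym dyt)))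
      (d+d⇒interval (trans (cong₂ _+_ (trans (d-sym t w) dwt) (d-adj (adj-sym xw)))
        (trans (+-comm k 1) (sym (trans (d-sym t x) dxt)))))

  four-cycle-reverse : FourCycle Adj u v y x → FourCycle Adj v u x y
  four-cycle-reverse (uv , vy , yx , xu , u≢y , v≢x) =
    adj-sym uv , adj-sym xu , adj-sym yx , adj-sym vy , v≢x , u≢y

  -- Otherwise u and y would both be the median of v, x and w.
  four-cycle-preserves-< : FourCycle Adj u v y x → ∀ w → d w u < d w v → d w x < d w y
  four-cycle-preserves-< {u} {v} {y} {x} (uv , vy , yx , xu , u≢y , v≢x) w u<v
    with d w x <? d w y
  ... | yes x<y = x<y
  ... | no x≮y = contradiction (trans u-is-median (sym y-is-median)) u≢y
    where
    dwv : d w v ≡ suc (d w u)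
    dwv = adj-<⇒≡suc uv u<v
    dwx≡suc-dwy : d w x ≡ suc (d w y)
    dwx≡suc-dwy = adj-<⇒≡suc yx (adj-≮⇒> (adj-sym yx) x≮y)
    dwy : d w y ≡ d w u
    dwy = ≤-antisym
      (≤-pred (subst (_≤ suc (d w u)) dwx≡suc-dwy (d-stepʳ (adj-sym xu) w)))
      (≤-pred (subst (_≤ suc (d w y)) dwv (d-stepʳ (adj-sym vy) w)))
    dwx : d w x ≡ suc (d w u)
    dwx = trans dwx≡suc-dwy (cong suc dwy)
    dvx : d v x ≡ 2
    dvx = common-neighbour-distance (adj-sym uv) (adj-sym xu) v≢x
    u-is-median : u ≡ proj₁ (median v x w)
    u-is-median = quadrangle-is-median (adj-sym uv) (adj-sym xu) dvx (d-sym u w)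
      (trans (d-sym v w) dwv) (trans (d-sym x w) dwx)
    y-is-median : y ≡ proj₁ (median v x w)
    y-is-median = quadrangle-is-median vy yx dvx (trans (d-sym y w) dwy)
      (trans (d-sym v w) dwv) (trans (d-sym x w) dwx)

  -- By bipartiteness, false means that w is strictly nearer to q.
  side : Dart Adj → Fin n → Bool
  side (p , q , _) w = does (d w p <? d w q)

  side-true : (pq : Adj p q) → d w p < d w q → side (p , q , pq) w ≡ true
  side-true {p = p} {q = q} {w = w} _ = dec-true (d w p <? d w q)

  side-false : (pq : Adj p q) → ¬ d w p < d w q → side (p , q , pq) w ≡ false
  side-false {p = p} {q = q} {w = w} _ = dec-false (d w p <? d w q)

  side-reverse : (pq : Adj p q) (qp : Adj q p) →
    ∀ w → side (q , p , qp) w ≡ not (side (p , q , pq) w)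
  side-reverse {p} {q} pq qp w with d w p <? d w q
  ... | yes p<q = trans (side-false qp (<-asym p<q)) (cong not (sym (side-true pq p<q)))
  ... | no p≮q  = trans (side-true qp (adj-≮⇒> pq p≮q)) (cong not (sym (side-false pq p≮q)))

  side-four-cycle : (uv : Adj u v) (xy : Adj x y) → FourCycle Adj u v y x →
    ∀ w → side (x , y , xy) w ≡ side (u , v , uv) w
  side-four-cycle {u = u} {v = v} {x = x} {y = y} uv xy C w with d w u <? d w v
  ... | yes u<v = trans (side-true xy (four-cycle-preserves-< C w u<v)) (sym (side-true uv u<v))
  ... | no u≮v = trans (side-false xy (<-asym y<x)) (sym (side-false uv u≮v))
    where
    y<x : d w y < d w x
    y<x = four-cycle-preserves-< (four-cycle-reverse C) w (adj-≮⇒> uv u≮v)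

  SameCut : Dart Adj → Dart Adj → Set
  SameCut e f = ∀ w w′ → (side e w ≡ side e w′) ⇔ (side f w ≡ side f w′)

  relabelled-side⇒SameCut : (h : Bool → Bool) → (∀ {β γ} → h β ≡ h γ → β ≡ γ) →
                            (∀ w → side f w ≡ h (side e w)) → SameCut e f
  relabelled-side⇒SameCut h h-injective f≡h∘e w w′ = mk⇔
    (λ eq → trans (f≡h∘e w) (trans (cong h eq) (sym (f≡h∘e w′))))
    (λ eq → h-injective (trans (sym (f≡h∘e w)) (trans eq (f≡h∘e w′))))

  step⇒SameCut : Step Adj e f → SameCut e f
  step⇒SameCut (θ₀ uv xy C) =
    relabelled-side⇒SameCut {f = _ , _ , xy} {e = _ , _ , uv} id id (side-four-cycle uv xy C)
  step⇒SameCut (flip pq qp) =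
    relabelled-side⇒SameCut {f = _ , _ , qp} {e = _ , _ , pq} not not-injective
      (side-reverse pq qp)

  Θ⇒SameCut : Θ Adj e f → SameCut e f
  Θ⇒SameCut ε w w′ = ⇔.refl
  Θ⇒SameCut (s ◅ θ) w w′ = ⇔.trans (step⇒SameCut s w w′) (Θ⇒SameCut θ w w′)

  data Crossing (e : Dart Adj) (x y : Fin n) (k : ℕ) : Set where
    crossing : AnyWalk x p i → (pq : Adj p q) → AnyWalk q y j → i + suc j ≡ k →
      Θ Adj e (p , q , pq) → Crossing e x y k

  avoid-unless-crossing : AnyWalk x y k → ¬ Crossing e x y k →
                          Walk Adj (NotInClass Adj e) x y k
  avoid-unless-crossing [] _ = []
  avoid-unless-crossing (step xz _ w₁) no-crossing =
    step xz (λ xz′ θ → no-crossing (crossing [] xz′ w₁ refl θ))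
      (avoid-unless-crossing w₁ λ { (crossing A pq B len θ) →
        no-crossing (crossing (step xz tt A) pq B (cong suc len) θ) })

  -- Θ is not decidable, so the crossing edge cannot be located; the double negation
  -- suffices because it is only used to derive a contradiction.
  separating-class-is-crossed : Separates Adj e x y → AnyWalk x y k → ¬ ¬ Crossing e x y k
  separating-class-is-crossed separates w₁ no-crossing =
    separates _ (avoid-unless-crossing w₁ no-crossing)

  separates-sym : Separates Adj e x y → Separates Adj e y x
  separates-sym {e = e} separates k w₁ = separates k (reverse not-in-class-sym w₁)
    where
    not-in-class-sym : Adj u v → NotInClass Adj e u v → NotInClass Adj e v u
    not-in-class-sym uv avoid vu θ = avoid uv (θ ◅◅ flip vu uv ◅ ε)

  -- pq separates u from m while p′q′ does not, so the two edges cannot cut alike.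
  geodesic-crosses-class-once : d u v ≡ d u m + d m v →
    Crossing e u m (d u m) → ¬ Crossing e m v (d m v)
  geodesic-crosses-class-once {u} {v} {m} geo (crossing {p = p} {q = q} A pq B len θ)
    (crossing {p = p′} {i = i′} {q = q′} {j = j′} C pq′ D len′ θ′) =
    pq-splits (Equivalence.from (same-cut u m) p′q′-does-not-split)
    where
    same-cut : SameCut (p , q , pq) (p′ , q′ , pq′)
    same-cut w w′ = ⇔.trans (⇔.sym (Θ⇒SameCut θ w w′)) (Θ⇒SameCut θ′ w w′)
    u-near-p : d u p < d u q
    u-near-p = proj₁ (geodesic-crosses-edge A pq B (sym len))
    m-near-q : d m q < d m p
    m-near-q = proj₂ (geodesic-crosses-edge A pq B (sym len))
    m-near-p′ : d m p′ < d m q′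
    m-near-p′ = proj₁ (geodesic-crosses-edge C pq′ D (sym len′))
    u-near-p′ : d u p′ < d u q′
    u-near-p′ = proj₁ (geodesic-crosses-edge (geodesic u m ++ʷ C) pq′ D
      (trans geo (trans (cong (d u m +_) (sym len′)) (sym (+-assoc (d u m) i′ (suc j′))))))
    pq-splits : side (p , q , pq) u ≢ side (p , q , pq) m
    pq-splits eq
      with trans (sym (side-true pq u-near-p)) (trans eq (side-false pq (<-asym m-near-q)))
    ... | ()
    p′q′-does-not-split : side (p′ , q′ , pq′) u ≡ side (p′ , q′ , pq′) m
    p′q′-does-not-split =
      trans (side-true pq′ u-near-p′) (sym (side-true pq′ m-near-p′))

  interval⇒ladders-disjoint : InInterval Adj u v m →
                              Disjoint Adj (Ladder Adj m u) (Ladder Adj m v)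
  interval⇒ladders-disjoint {u} {v} {m} I e ((m|u , _) , (m|v , _)) =
    separating-class-is-crossed (separates-sym m|u) (geodesic u m) λ c₁ →
    separating-class-is-crossed m|v (geodesic m v) λ c₂ →
    geodesic-crosses-class-once (sym (interval⇒d+d I)) c₁ c₂

  Θ-same-ends : (pq : Adj p q) (ab : Adj a b) → a ≡ p → b ≡ q →
                Θ Adj (p , q , pq) (a , b , ab)
  Θ-same-ends pq ab refl refl = flip pq (adj-sym pq) ◅ flip (adj-sym pq) ab ◅ ε

  -- For the neighbour x of a towards p, closing the quadrangle on x, a, b yields a parallel
  -- crossing edge xw one step closer to p.
  crossing-square : (pq : Adj p q) (ab : Adj a b) (ax : Adj a x) →
    d x p ≡ k → d a p ≡ suc k → d a p < d a q → d b q < d b p →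
    Σ (Fin n) λ w → Σ (Adj x w) λ xw →
      FourCycle Adj x w b a × d x p < d x q × d w q < d w p
  crossing-square {p} {q} {a} {b} {x} {k} pq ab ax dxp dap a-near-p b-near-q =
    complete (quadrangle dxb dxq dbq)
    where
    daq : d a q ≡ suc (suc k)
    daq = trans (adj-<⇒≡suc pq a-near-p) (cong suc dap)
    dbp≡suc-dbq : d b p ≡ suc (d b q)
    dbp≡suc-dbq = adj-<⇒≡suc (adj-sym pq) b-near-q
    dbq : d b q ≡ suc k
    dbq = ≤-antisym
      (≤-pred (subst (_≤ suc (suc k)) dbp≡suc-dbq
        (≤-trans (d-stepˡ ab p) (s≤s (≤-reflexive dap)))))
      (≤-pred (subst (_≤ suc (d b q)) daq (d-stepˡ (adj-sym ab) q)))
    dbp : d b p ≡ suc (suc k)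
    dbp = trans dbp≡suc-dbq (cong suc dbq)
    dxq : d x q ≡ suc k
    dxq = ≤-antisym (≤-trans (d-stepʳ pq x) (s≤s (≤-reflexive dxp)))
      (≤-pred (subst (_≤ suc (d x q)) daq (d-stepˡ (adj-sym ax) q)))
    x≢b : x ≢ b
    x≢b = distinct-levels dxp dbp
    dxb : d x b ≡ 2
    dxb = common-neighbour-distance (adj-sym ax) ab x≢b
    complete : Σ (Fin n) (λ w → Adj x w × Adj w b × d w q ≡ k) →
      Σ (Fin n) λ w → Σ (Adj x w) λ xw →
        FourCycle Adj x w b a × d x p < d x q × d w q < d w p
    complete (w , xw , wb , dwq) =
      w , xw , (xw , wb , adj-sym ab , ax , x≢b , distinct-levels dwq daq) ,
      subst₂ _<_ (sym dxp) (sym dxq) ≤-refl , subst₂ _<_ (sym dwq) (sym dwp) ≤-refl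
      where
      dwp : d w p ≡ suc k
      dwp = ≤-antisym (≤-trans (d-stepˡ xw p) (s≤s (≤-reflexive dxp)))
        (≤-pred (subst (_≤ suc (d w p)) dbp (d-stepˡ wb p)))

  Θ-of-crossing-edge : ∀ k (pq : Adj p q) (ab : Adj a b) →
    d a p ≡ k → d a p < d a q → d b q < d b p → Θ Adj (p , q , pq) (a , b , ab)
  Θ-of-crossing-edge {p} {q} {a} {b} zero pq ab dap _ b-near-q = Θ-same-ends pq ab a≡p b≡q
    where
    a≡p : a ≡ p
    a≡p = d≡0⇒≡ dap
    dbp : d b p ≡ 1
    dbp = trans (cong (d b) (sym a≡p)) (d-adj (adj-sym ab))
    b≡q : b ≡ q
    b≡q = d≡0⇒≡ (n<1⇒n≡0 (subst (d b q <_) dbp b-near-q))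
  Θ-of-crossing-edge (suc k) pq ab dap a-near-p b-near-q with first-step dap
  ... | x , ax , dxp with crossing-square pq ab ax dxp dap a-near-p b-near-q
  ... | w , xw , square , x-near-p , w-near-q =
    Θ-of-crossing-edge k pq xw dxp x-near-p w-near-q ◅◅ θ₀ xw ab square ◅ ε

  class-avoiding-walk-keeps-side : (pq : Adj p q) →
    Walk Adj (NotInClass Adj (p , q , pq)) x y k → d x p < d x q → d y p < d y q
  class-avoiding-walk-keeps-side pq [] x-near = x-near
  class-avoiding-walk-keeps-side {p} {q} pq (step {v = z} xz avoid w₁) x-near with d z p <? d z q
  ... | yes z-near = class-avoiding-walk-keeps-side pq w₁ z-near
  ... | no z-far =
    contradiction (Θ-of-crossing-edge _ pq xz refl x-near (adj-≮⇒> pq z-far)) (avoid xz)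

  edge-separates : (pq : Adj p q) → d x p < d x q → d y q < d y p →
                   Separates Adj (p , q , pq) x y
  edge-separates pq x-near y-near _ w₁ =
    <-asym (class-avoiding-walk-keeps-side pq w₁ x-near) y-near

  nearer-through-interval : InInterval Adj t m z → d y z < d m z → d t y < d t m
  nearer-through-interval {t} {m} {z} {y} I y-nearer = begin-strict
    d t y         ≤⟨ d-triangle t z y ⟩
    d t z + d z y <⟨ +-monoʳ-< (d t z) (subst₂ _<_ (d-sym y z) (d-sym m z) y-nearer) ⟩
    d t z + d z m ≡⟨ interval⇒d+d I ⟩
    d t m         ∎
    where open ≤-Reasoning

  ladders-disjoint⇒interval : Disjoint Adj (Ladder Adj m u) (Ladder Adj m v) →
                              InInterval Adj u v m
  ladders-disjoint⇒interval {m} {u} {v} disjoint with median m u v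
  ... | z , (I-mu , I-uv , I-vm) , _ with z ≟ᶠ m
  ... | yes refl = I-uv
  ... | no z≢m with neighbour-toward (z≢m ∘ sym)
  ... | y , my , y-nearer =
    contradiction (in-ladder u (interval-sym I-mu) , in-ladder v I-vm) (disjoint (m , y , my))
    where
    m-near-m : d m m < d m y
    m-near-m = subst₂ _<_ (sym (d-refl m)) (sym (d-adj my)) (s≤s z≤n)
    in-ladder : ∀ t → InInterval Adj t m z → Ladder Adj m t (m , y , my)
    in-ladder t I = edge-separates my m-near-m (nearer-through-interval I y-nearer) , y , my , ε

theorem7 : (n : ℕ) (Adj : Fin n → Fin n → Set) → IsMedianGraph Adj →
    (v₀ m : Fin n) (L L* : EdgeSet Adj) →
    IsClassSet Adj L → IsPOF Adj L → OutgoingFrom Adj v₀ m L →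
    IsClassSet Adj L* → IsPOF Adj L* → OutgoingFrom Adj v₀ m L* →
    (u v : Fin n) → InInterval Adj v₀ u m → InInterval Adj v₀ v m →
    SameSet Adj (Ladder Adj m u) L → SameSet Adj (Ladder Adj m v) L* →
    (InInterval Adj u v m ⇔ Disjoint Adj L L*)
theorem7 n Adj G v₀ m L L* _ _ _ _ _ _ u v _ _ L≈ L*≈ = mk⇔
  (λ I e (Le , L*e) → interval⇒ladders-disjoint I e (proj₂ (L≈ e) Le , proj₂ (L*≈ e) L*e))
  (λ disjoint → ladders-disjoint⇒interval λ e (lu , lv) →
    disjoint e (proj₁ (L≈ e) lu , proj₁ (L*≈ e) lv))
  where open MedianGraph G
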